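{- Let $\omega:\mathbb{Z}\to\mathbb{Z}$ be a bijection whose inversion graph $G(\omega)$ is a doubly infinite path. Then $\omega$ is order-isomorphic to either $\mathcal{O}$ or $\Sigma\mathcal{O}$. That is, there exist order-preserving bijections $\phi,\phi':\mathbb{Z}\to\mathbb{Z}$ with $\omega\circ\phi=\phi'\circ\mathcal{O}$ or $\omega\circ\phi=\phi'\circ\Sigma\mathcal{O}$.
   Context: The inversion graph $G(\omega)$ of a bijection $\omega$ between ordered sets has vertex set the domain and an edge $\{i,j\}$ whenever $i<j$ and $\omega(i)>\omega(j)$. $\mathcal{O}:\mathbb{Z}\to\mathbb{Z}$ is the infinite oscillation: $\mathcal{O}(i)=i+2$ for odd $i$ and $\mathcal{O}(i)=i-2$ for even $i$. $\Sigma\mathcal{O}(i)=\mathcal{O}(i-1)+1$. -}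

module Defs where

open import Data.Bool using (Bool; true; false; if_then_else_)
open import Data.Nat as ℕ using (ℕ; _%_; _≡ᵇ_)
open import Data.Integer using (ℤ; +_; _+_; _-_; _<_; ∣_∣; 1ℤ)
open import Data.Product using (Σ; _×_; ∃; ∃-syntax)
open import Data.Sum using (_⊎_)
open import Function.Definitions using (Bijective)
open import Relation.Binary.PropositionalEquality using (_≡_)

Bij : (ℤ → ℤ) → Set
Bij f = Bijective _≡_ _≡_ f

OrderIso : (ℤ → ℤ) → Set
OrderIso φ = ((a b : ℤ) → a < b → φ a < φ b) × Bij φ

isOdd : ℤ → Bool
isOdd i = (∣ i ∣ % 2) ≡ᵇ 1

osc : ℤ → ℤ
osc i = if isOdd i then i + + 2 else i - + 2

Σosc : ℤ → ℤ
Σosc i = osc (i - 1ℤ) + 1ℤ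

InvEdge : (ℤ → ℤ) → ℤ → ℤ → Set
InvEdge ω i j = (i < j × ω j < ω i) ⊎ (j < i × ω i < ω j)

PathEdge : ℤ → ℤ → Set
PathEdge a b = (b ≡ a + 1ℤ) ⊎ (a ≡ b + 1ℤ)

IsDoublyInfinitePath : (ℤ → ℤ → Set) → Set
IsDoublyInfinitePath E =
  ∃[ ψ ] (Bij ψ × ((a b : ℤ) → (E (ψ a) (ψ b) → PathEdge a b) × (PathEdge a b → E (ψ a) (ψ b))))

module Submission where

-- Lemma 5.4.  If ω : ℤ → ℤ is a bijection whose inversion graph G(ω) is a doubly
-- infinite path, then ω is a translate of ΣO: ω (i + c) = ΣO i + d for some c, d,
-- so the translations φ = (_+ c) and φ′ = (_+ d) witness the second alternative.

open import Defs
open import Data.Bool using (true; false; if_then_else_)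
open import Data.Nat as ℕ using (ℕ; zero; suc)
import Data.Nat.Properties as ℕP
open import Data.Integer using (ℤ; +_; -[1+_]; _+_; _-_; _*_; -_; _<_; _≤_; 0ℤ; 1ℤ; +<+; -<+)
import Data.Integer.Properties as ℤP
open import Data.Integer.Tactic.RingSolver using (solve-∀)
open import Data.Product using (_×_; _,_; proj₁; proj₂; ∃-syntax)
open import Data.Sum as Sum using (_⊎_; inj₁; inj₂)
open import Data.Empty using (⊥; ⊥-elim)
open import Function using (_∘_)
open import Relation.Nullary using (¬_; yes; no)
open import Relation.Nullary.Decidable using (True; toWitness)
open import Relation.Binary.Definitions using (tri<; tri≈; tri>)
open import Relation.Binary.PropositionalEquality
  using (_≡_; _≢_; refl; sym; trans; cong; subst; subst₂; ≢-sym; module ≡-Reasoning)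

add-sub : ∀ x d → (x + d) - d ≡ x
add-sub = solve-∀

sub-add : ∀ x d → (x - d) + d ≡ x
sub-add = solve-∀

+1-1 : ∀ x → (x + 1ℤ) - 1ℤ ≡ x
+1-1 x = add-sub x 1ℤ

-1+1 : ∀ x → (x - 1ℤ) + 1ℤ ≡ x
-1+1 x = sub-add x 1ℤ

shift-< : ∀ x (m n : ℕ) {m<n : True (m ℕ.<? n)} → x + + m < x + + n
shift-< x m n {m<n} = ℤP.+-monoʳ-< x (+<+ (toWitness m<n))

base-< : ∀ x (n : ℕ) → x < x + + suc n
base-< x n = subst (_< x + + suc n) (ℤP.+-identityʳ x) (shift-< x 0 (suc n))

<-+1 : ∀ x → x < x + 1ℤ
<-+1 x = base-< x 0

-1-< : ∀ x → x - 1ℤ < x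
-1-< x = subst (x - 1ℤ <_) (ℤP.+-identityʳ x) (ℤP.+-monoʳ-< x -<+)

shift-suc : ∀ x (n : ℕ) → (x + + n) + 1ℤ ≡ x + + suc n
shift-suc x n = trans (ℤP.+-assoc x (+ n) 1ℤ) (cong (λ m → x + + m) (ℕP.+-comm n 1))

successor-or-beyond : ∀ {i j} → i < j → j ≡ i + 1ℤ ⊎ i + 1ℤ < j
successor-or-beyond {i} {j} i<j with j ℤP.≟ i + 1ℤ
... | yes j≡i+1 = inj₁ j≡i+1
... | no j≢i+1 =
  inj₂ (ℤP.≤∧≢⇒< (subst (_≤ j) (ℤP.+-comm 1ℤ i) (ℤP.i<j⇒suc[i]≤j i<j)) (≢-sym j≢i+1))

next-offset-or-beyond : ∀ x (n : ℕ) {j} → x + + n < j → j ≡ x + + suc n ⊎ x + + suc n < j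
next-offset-or-beyond x n x+n<j =
  Sum.map (λ j≡ → trans j≡ (shift-suc x n)) (subst (_< _) (shift-suc x n))
          (successor-or-beyond x+n<j)

predecessor-or-below : ∀ {i j} → i < j → i ≡ j - 1ℤ ⊎ i < j - 1ℤ
predecessor-or-below {i} i<j with successor-or-beyond i<j
... | inj₁ refl = inj₁ (sym (+1-1 i))
... | inj₂ i+1<j = inj₂ (subst (_< _) (+1-1 i) (ℤP.+-monoˡ-< (- 1ℤ) i+1<j))

nothing-between : ∀ {i j} → i < j → j < i + 1ℤ → ⊥
nothing-between i<j j<i+1 with successor-or-beyond i<j
... | inj₁ refl = ℤP.<-irrefl refl j<i+1
... | inj₂ i+1<j = ℤP.<-asym i+1<j j<i+1

strictly-between-+2 : ∀ {k c} → k < c → c < k + + 2 → c ≡ k + 1ℤ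
strictly-between-+2 {k} k<c c<k+2 with successor-or-beyond k<c
... | inj₁ c≡k+1 = c≡k+1
... | inj₂ k+1<c = ⊥-elim (nothing-between k+1<c (subst (_ <_) (sym (ℤP.+-assoc k 1ℤ 1ℤ)) c<k+2))

successor-of : ∀ {a x} → a < x → (∀ v → a < v → v < x → ⊥) → x ≡ a + 1ℤ
successor-of {a} a<x empty with successor-or-beyond a<x
... | inj₁ x≡a+1 = x≡a+1
... | inj₂ a+1<x = ⊥-elim (empty (a + 1ℤ) (<-+1 a) a+1<x)

four-consecutive : ∀ {a p q b} → a < p → p < q → q < b →
  (∀ v → a < v → v < b → v ≡ p ⊎ v ≡ q) → p ≡ a + 1ℤ × q ≡ p + 1ℤ × b ≡ q + 1ℤ
four-consecutive {a} {p} {q} {b} a<p p<q q<b only =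
    successor-of a<p (λ v a<v v<p →
      excluded (ℤP.<⇒≢ v<p) (ℤP.<⇒≢ (ℤP.<-trans v<p p<q)) a<v (ℤP.<-trans v<p p<b))
  , successor-of p<q (λ v p<v v<q →
      excluded (≢-sym (ℤP.<⇒≢ p<v)) (ℤP.<⇒≢ v<q) (ℤP.<-trans a<p p<v) (ℤP.<-trans v<q q<b))
  , successor-of q<b (λ v q<v v<b →
      excluded (≢-sym (ℤP.<⇒≢ (ℤP.<-trans p<q q<v))) (≢-sym (ℤP.<⇒≢ q<v)) (ℤP.<-trans a<q q<v) v<b)
  where
  p<b : p < b
  p<b = ℤP.<-trans p<q q<b
  a<q : a < q
  a<q = ℤP.<-trans a<p p<q
  excluded : ∀ {v} → v ≢ p → v ≢ q → a < v → v < b → ⊥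
  excluded {v} v≢p v≢q a<v v<b = Sum.[ v≢p , v≢q ] (only v a<v v<b)

ℤ-induction : (P : ℤ → Set) → P 0ℤ → (∀ t → P t → P (t + 1ℤ)) → (∀ t → P t → P (t - 1ℤ)) →
              ∀ t → P t
ℤ-induction P p₀ up down (+ n) = upwards n
  where
  upwards : ∀ n → P (+ n)
  upwards zero = p₀
  upwards (suc n) = subst P (cong +_ (ℕP.+-comm n 1)) (up (+ n) (upwards n))
ℤ-induction P p₀ up down -[1+ n ] = downwards n
  where
  downwards : ∀ n → P -[1+ n ]
  downwards zero = down 0ℤ p₀
  downwards (suc n) = subst P (cong (λ m → -[1+ suc m ]) (ℕP.+-identityʳ n)) (down -[1+ n ] (downwards n))

arithmetic-progression : ∀ (g : ℤ → ℤ) d → (∀ t → g (t + 1ℤ) ≡ g t + d) → ∀ t → g t ≡ g 0ℤ + d * t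
arithmetic-progression g d step = ℤ-induction (λ t → g t ≡ g 0ℤ + d * t) (zero-term (g 0ℤ) d) up down
  where
  zero-term : ∀ a d → a ≡ a + d * 0ℤ
  zero-term = solve-∀
  next-term : ∀ a d t → (a + d * t) + d ≡ a + d * (t + 1ℤ)
  next-term = solve-∀
  previous-term : ∀ a d t → (a + d * t) - d ≡ a + d * (t - 1ℤ)
  previous-term = solve-∀
  open ≡-Reasoning
  up : ∀ t → g t ≡ g 0ℤ + d * t → g (t + 1ℤ) ≡ g 0ℤ + d * (t + 1ℤ)
  up t gt = trans (step t) (trans (cong (_+ d) gt) (next-term (g 0ℤ) d t))
  down : ∀ t → g t ≡ g 0ℤ + d * t → g (t - 1ℤ) ≡ g 0ℤ + d * (t - 1ℤ)
  down t gt = begin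
    g (t - 1ℤ)                  ≡⟨ sym (add-sub (g (t - 1ℤ)) d) ⟩
    (g (t - 1ℤ) + d) - d        ≡⟨ cong (_- d) (sym (step (t - 1ℤ))) ⟩
    g ((t - 1ℤ) + 1ℤ) - d       ≡⟨ cong (λ s → g s - d) (-1+1 t) ⟩
    g t - d                     ≡⟨ cong (_- d) gt ⟩
    (g 0ℤ + d * t) - d          ≡⟨ previous-term (g 0ℤ) d t ⟩
    g 0ℤ + d * (t - 1ℤ)         ∎

translation-iso : ∀ d → OrderIso (λ x → x + d)
translation-iso d =
    (λ a b a<b → ℤP.+-monoˡ-< d a<b)
  , (λ {x} {y} x+d≡y+d → trans (sym (add-sub x d)) (trans (cong (_- d) x+d≡y+d) (add-sub y d)))
  , (λ y → y - d , λ z≡y-d → trans (cong (_+ d) z≡y-d) (sub-add y d))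

ℕ-parity : ∀ (n : ℕ) → (((n ℕ.% 2) ℕ.≡ᵇ 1) ≡ true × ∃[ m ] n ≡ suc (m ℕ.+ m))
               ⊎ (((n ℕ.% 2) ℕ.≡ᵇ 1) ≡ false × ∃[ m ] n ≡ m ℕ.+ m)
ℕ-parity 0 = inj₂ (refl , 0 , refl)
ℕ-parity 1 = inj₁ (refl , 0 , refl)
ℕ-parity (suc (suc n)) with ℕ-parity n
... | inj₁ (odd , m , refl) = inj₁ (odd , suc m , cong (suc ∘ suc) (sym (ℕP.+-suc m m)))
... | inj₂ (even , m , refl) = inj₂ (even , suc m , cong suc (sym (ℕP.+-suc m m)))

ℤ-parity : ∀ j → (isOdd j ≡ true × ∃[ t ] j ≡ + 2 * t + 1ℤ) ⊎ (isOdd j ≡ false × ∃[ t ] j ≡ + 2 * t)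
ℤ-parity (+ n) with ℕ-parity n
... | inj₁ (odd , m , refl) = inj₁ (odd , + m , odd-form (+ m))
  where
  odd-form : ∀ x → 1ℤ + (x + x) ≡ + 2 * x + 1ℤ
  odd-form = solve-∀
... | inj₂ (even , m , refl) = inj₂ (even , + m , even-form (+ m))
  where
  even-form : ∀ x → x + x ≡ + 2 * x
  even-form = solve-∀
ℤ-parity -[1+ n ] with ℕ-parity (suc n)
... | inj₁ (odd , m , refl) = inj₁ (odd , - + m - 1ℤ , negated-odd (+ m))
  where
  negated-odd : ∀ x → - (1ℤ + (x + x)) ≡ + 2 * (- x - 1ℤ) + 1ℤ
  negated-odd = solve-∀
... | inj₂ (even , m , n+1≡m+m) = inj₂ (even , - + m , trans (cong (-_ ∘ +_) n+1≡m+m) (negated-even (+ m)))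
  where
  negated-even : ∀ x → - (x + x) ≡ + 2 * (- x)
  negated-even = solve-∀

osc-odd : ∀ j → isOdd j ≡ true → osc j ≡ j + + 2
osc-odd j odd = cong (λ b → if b then j + + 2 else j - + 2) odd

osc-even : ∀ j → isOdd j ≡ false → osc j ≡ j - + 2
osc-even j even = cong (λ b → if b then j + + 2 else j - + 2) even

Σosc-halves : ∀ i → (∃[ t ] i ≡ + 2 * t × Σosc i ≡ i + + 2) ⊎ (∃[ t ] i ≡ + 2 * t + 1ℤ × Σosc i ≡ i - + 2)
Σosc-halves i with ℤ-parity (i - 1ℤ)
... | inj₁ (odd , t , i-1≡) =
  inj₁ (t + 1ℤ , trans (sym (-1+1 i)) (trans (cong (_+ 1ℤ) i-1≡) (even-form t))
               , trans (cong (_+ 1ℤ) (osc-odd (i - 1ℤ) odd)) (up-form i))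
  where
  even-form : ∀ t → (+ 2 * t + 1ℤ) + 1ℤ ≡ + 2 * (t + 1ℤ)
  even-form = solve-∀
  up-form : ∀ i → ((i - 1ℤ) + + 2) + 1ℤ ≡ i + + 2
  up-form = solve-∀
... | inj₂ (even , t , i-1≡) =
  inj₂ (t , trans (sym (-1+1 i)) (cong (_+ 1ℤ) i-1≡)
          , trans (cong (_+ 1ℤ) (osc-even (i - 1ℤ) even)) (down-form i))
  where
  down-form : ∀ i → ((i - 1ℤ) - + 2) + 1ℤ ≡ i - + 2
  down-form = solve-∀

matches-Σosc : ∀ (f : ℤ → ℤ) c e →
  (∀ t → f (c + + 2 * t) ≡ e + + 2 * t × f (c + + 2 * t + 1ℤ) ≡ e + + 2 * t - + 3) →
  ∀ i → f (i + c) ≡ Σosc i + (e - + 2)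
matches-Σosc f c e values i with Σosc-halves i
... | inj₁ (t , refl , Σosc≡) = begin
  f (+ 2 * t + c)              ≡⟨ cong f (ℤP.+-comm (+ 2 * t) c) ⟩
  f (c + + 2 * t)              ≡⟨ proj₁ (values t) ⟩
  e + + 2 * t                  ≡⟨ even-form e (+ 2 * t) ⟩
  (+ 2 * t + + 2) + (e - + 2)  ≡⟨ cong (_+ (e - + 2)) (sym Σosc≡) ⟩
  Σosc (+ 2 * t) + (e - + 2)   ∎
  where
  open ≡-Reasoning
  even-form : ∀ e s → e + s ≡ (s + + 2) + (e - + 2)
  even-form = solve-∀
... | inj₂ (t , refl , Σosc≡) = begin
  f (+ 2 * t + 1ℤ + c)                   ≡⟨ cong f (rearrange (+ 2 * t) c) ⟩
  f (c + + 2 * t + 1ℤ)                   ≡⟨ proj₂ (values t) ⟩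
  e + + 2 * t - + 3                      ≡⟨ odd-form e (+ 2 * t) ⟩
  (+ 2 * t + 1ℤ - + 2) + (e - + 2)       ≡⟨ cong (_+ (e - + 2)) (sym Σosc≡) ⟩
  Σosc (+ 2 * t + 1ℤ) + (e - + 2)        ∎
  where
  open ≡-Reasoning
  rearrange : ∀ s c → s + 1ℤ + c ≡ c + s + 1ℤ
  rearrange = solve-∀
  odd-form : ∀ e s → e + s - + 3 ≡ (s + 1ℤ - + 2) + (e - + 2)
  odd-form = solve-∀

module PathGraph {E : ℤ → ℤ → Set} (path : IsDoublyInfinitePath E) where

  ψ : ℤ → ℤ
  ψ = proj₁ path

  ψ-injective : ∀ {a b} → ψ a ≡ ψ b → a ≡ b
  ψ-injective = proj₁ (proj₁ (proj₂ path))

  pos : ℤ → ℤ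
  pos v = proj₁ (proj₂ (proj₁ (proj₂ path)) v)

  ψ-pos : ∀ v → ψ (pos v) ≡ v
  ψ-pos v = proj₂ (proj₂ (proj₁ (proj₂ path)) v) refl

  ψ-edge→step : ∀ {a b} → E (ψ a) (ψ b) → PathEdge a b
  ψ-edge→step {a} {b} = proj₁ (proj₂ (proj₂ path) a b)

  step→ψ-edge : ∀ {a b} → PathEdge a b → E (ψ a) (ψ b)
  step→ψ-edge {a} {b} = proj₂ (proj₂ (proj₂ path) a b)

  edge→step : ∀ {v w} → E v w → PathEdge (pos v) (pos w)
  edge→step {v} {w} e = ψ-edge→step (subst₂ E (sym (ψ-pos v)) (sym (ψ-pos w)) e)

  same-position : ∀ {a b} → pos a ≡ pos b → a ≡ b
  same-position {a} {b} eq = trans (sym (ψ-pos a)) (trans (cong ψ eq) (ψ-pos b))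

  next prev : ℤ → ℤ
  next v = ψ (pos v + 1ℤ)
  prev v = ψ (pos v - 1ℤ)

  edge-next : ∀ v → E v (next v)
  edge-next v = subst (λ u → E u (next v)) (ψ-pos v) (step→ψ-edge (inj₁ refl))

  edge-prev : ∀ v → E v (prev v)
  edge-prev v = subst (λ u → E u (prev v)) (ψ-pos v) (step→ψ-edge (inj₂ (sym (-1+1 (pos v)))))

  next≢prev : ∀ v → next v ≢ prev v
  next≢prev v eq = ℤP.<-irrefl (sym (ψ-injective eq)) (ℤP.+-monoʳ-< (pos v) -<+)

  neighbours : ∀ {v w} → E v w → w ≡ next v ⊎ w ≡ prev v
  neighbours {v} {w} e with edge→step e
  ... | inj₁ w-after = inj₁ (trans (sym (ψ-pos w)) (cong ψ w-after))
  ... | inj₂ v-after =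
    inj₂ (trans (sym (ψ-pos w)) (cong ψ (trans (sym (+1-1 (pos w))) (cong (_- 1ℤ) (sym v-after)))))

  symmetric : ∀ {v w} → E v w → E w v
  symmetric {v} {w} e = subst₂ E (ψ-pos w) (ψ-pos v) (step→ψ-edge (Sum.swap (edge→step e)))

  irreflexive : ∀ {v} → ¬ E v v
  irreflexive {v} e with edge→step e
  ... | inj₁ loop = ℤP.<-irrefl loop (<-+1 (pos v))
  ... | inj₂ loop = ℤP.<-irrefl loop (<-+1 (pos v))

  another-neighbour : ∀ v a → ∃[ b ] b ≢ a × E v b
  another-neighbour v a with a ℤP.≟ next v
  ... | yes a≡next = prev v , (λ prev≡a → next≢prev v (sym (trans prev≡a a≡next))) , edge-prev v
  ... | no a≢next = next v , ≢-sym a≢next , edge-next v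

  at-most-two : ∀ {v a b w} → E v a → E v b → a ≢ b → E v w → w ≡ a ⊎ w ≡ b
  at-most-two ea eb a≢b ew with neighbours ea | neighbours eb | neighbours ew
  ... | inj₁ a+ | inj₁ b+ | _ = ⊥-elim (a≢b (trans a+ (sym b+)))
  ... | inj₂ a- | inj₂ b- | _ = ⊥-elim (a≢b (trans a- (sym b-)))
  ... | inj₁ a+ | inj₂ _  | inj₁ w+ = inj₁ (trans w+ (sym a+))
  ... | inj₁ _  | inj₂ b- | inj₂ w- = inj₂ (trans w- (sym b-))
  ... | inj₂ _  | inj₁ b+ | inj₁ w+ = inj₂ (trans w+ (sym b+))
  ... | inj₂ a- | inj₁ _  | inj₂ w- = inj₁ (trans w- (sym a-))

  -- positions pos v ± 1 are two apart, so the two neighbours of v are not adjacent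
  neighbours-apart : ∀ v → ¬ E (next v) (prev v)
  neighbours-apart v e with ψ-edge→step e
  ... | inj₁ x-1≡x+2 = ℤP.<-irrefl x-1≡x+2 (ℤP.<-trans (ℤP.+-monoʳ-< (pos v) -<+) (<-+1 _))
  ... | inj₂ x+1≡x = ℤP.<-irrefl (sym (trans x+1≡x (-1+1 (pos v)))) (<-+1 (pos v))

  triangle-free : ∀ {u v w} → E u v → E v w → E u w → ⊥
  triangle-free {u} {v} e₁ e₂ e₃ with neighbours (symmetric e₁) | neighbours e₂
  ... | inj₁ u+ | inj₁ w+ = irreflexive (subst (E u) (trans w+ (sym u+)) e₃)
  ... | inj₂ u- | inj₂ w- = irreflexive (subst (E u) (trans w- (sym u-)) e₃)
  ... | inj₁ u+ | inj₂ w- = neighbours-apart v (subst₂ E u+ w- e₃)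
  ... | inj₂ u- | inj₁ w+ = neighbours-apart v (symmetric (subst₂ E u- w+ e₃))

  -- two distinct vertices cannot share two distinct neighbours: a common neighbour of
  -- next a and prev a sits at position pos a ± 2 or at pos a itself
  square-free : ∀ {a b u w} → a ≢ b → u ≢ w → E a u → E a w → E b u → E b w → ⊥
  square-free {a} {b} a≢b u≢w eau eaw ebu ebw =
    positions (ψ-edge→step (to-ψ (shared (edge-next a)))) (ψ-edge→step (to-ψ (shared (edge-prev a))))
    where
    shared : ∀ {p} → E a p → E b p
    shared eap = Sum.[ (λ p≡u → subst (E b) (sym p≡u) ebu) , (λ p≡w → subst (E b) (sym p≡w) ebw) ]
                   (at-most-two eau eaw u≢w eap)
    to-ψ : ∀ {p} → E b p → E (ψ (pos b)) p
    to-ψ = subst (λ t → E t _) (sym (ψ-pos b))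
    x = pos a
    positions : PathEdge (pos b) (x + 1ℤ) → PathEdge (pos b) (x - 1ℤ) → ⊥
    positions (inj₁ x+1≡y+1) _ = a≢b (same-position (trans (sym (+1-1 x)) (trans (cong (_- 1ℤ) x+1≡y+1) (+1-1 _))))
    positions _ (inj₂ y≡x) = a≢b (same-position (sym (trans y≡x (-1+1 x))))
    positions (inj₂ y≡x+2) (inj₁ x-1≡y+1) =
      ℤP.<-irrefl (trans x-1≡y+1 (cong (_+ 1ℤ) y≡x+2))
        (ℤP.<-trans (-1-< x) (ℤP.<-trans (<-+1 x) (ℤP.<-trans (<-+1 _) (<-+1 _))))

module Convexity (ω : ℤ → ℤ) (ω-injective : ∀ {i j} → ω i ≡ ω j → i ≡ j) where

  edge→inverted : ∀ {i j} → i < j → InvEdge ω i j → ω j < ω i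
  edge→inverted i<j (inj₁ (_ , inverted)) = inverted
  edge→inverted i<j (inj₂ (j<i , _)) = ⊥-elim (ℤP.<-asym i<j j<i)

  inverted→edge : ∀ {i j} → i < j → ω j < ω i → InvEdge ω i j
  inverted→edge i<j inverted = inj₁ (i<j , inverted)

  non-edge→ordered : ∀ {i j} → i < j → ¬ InvEdge ω i j → ω i < ω j
  non-edge→ordered {i} {j} i<j no-edge with ℤP.<-cmp (ω i) (ω j)
  ... | tri< ordered _ _ = ordered
  ... | tri≈ _ same _ = ⊥-elim (ℤP.<-irrefl (ω-injective same) i<j)
  ... | tri> _ _ inverted = ⊥-elim (no-edge (inverted→edge i<j inverted))

  split : ∀ {i j k} → i < j → j < k → InvEdge ω i k → InvEdge ω i j ⊎ InvEdge ω j k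
  split {i} {j} {k} i<j j<k e with ℤP.<-cmp (ω j) (ω i)
  ... | tri< ωj<ωi _ _ = inj₁ (inverted→edge i<j ωj<ωi)
  ... | tri≈ _ same _ = ⊥-elim (ℤP.<-irrefl (ω-injective (sym same)) i<j)
  ... | tri> _ _ ωi<ωj = inj₂ (inverted→edge j<k (ℤP.<-trans (edge→inverted (ℤP.<-trans i<j j<k) e) ωi<ωj))

  transitive : ∀ {i j k} → i < j → j < k → InvEdge ω i j → InvEdge ω j k → InvEdge ω i k
  transitive i<j j<k e₁ e₂ =
    inverted→edge (ℤP.<-trans i<j j<k) (ℤP.<-trans (edge→inverted j<k e₂) (edge→inverted i<j e₁))

module PathInversionGraph (ω : ℤ → ℤ) (ω-bij : Bij ω) (path : IsDoublyInfinitePath (InvEdge ω)) where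

  open PathGraph {InvEdge ω} path
  open Convexity ω (proj₁ ω-bij)

  E : ℤ → ℤ → Set
  E = InvEdge ω

  ω⁻¹ : ℤ → ℤ
  ω⁻¹ v = proj₁ (proj₂ ω-bij v)

  ω-onto : ∀ v → ω (ω⁻¹ v) ≡ v
  ω-onto v = proj₂ (proj₂ ω-bij v) refl

  Between : ℤ → ℤ → ℤ → Set
  Between i j k = (i < j × j < k) ⊎ (k < j × j < i)

  split-between : ∀ {i j k} → Between i j k → E i k → E i j ⊎ E j k
  split-between (inj₁ (i<j , j<k)) e = split i<j j<k e
  split-between (inj₂ (k<j , j<i)) e = Sum.swap (Sum.map symmetric symmetric (split k<j j<i (symmetric e)))

  R L : ℤ → Set
  R v = ∀ w → E v w → v < w
  L v = ∀ w → E v w → w < v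

  -- a vertex with neighbours on both sides would lie on a triangle
  R-or-L : ∀ v → R v ⊎ L v
  R-or-L v with ℤP.<-cmp (next v) v | ℤP.<-cmp (prev v) v
  ... | tri≈ _ loop _ | _ = ⊥-elim (irreflexive (subst (E v) loop (edge-next v)))
  ... | _ | tri≈ _ loop _ = ⊥-elim (irreflexive (subst (E v) loop (edge-prev v)))
  ... | tri< n<v _ _ | tri< p<v _ _ =
    inj₂ λ w e → Sum.[ (λ w≡n → subst (_< v) (sym w≡n) n<v) , (λ w≡p → subst (_< v) (sym w≡p) p<v) ] (neighbours e)
  ... | tri> _ _ v<n | tri> _ _ v<p =
    inj₁ λ w e → Sum.[ (λ w≡n → subst (v <_) (sym w≡n) v<n) , (λ w≡p → subst (v <_) (sym w≡p) v<p) ] (neighbours e)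
  ... | tri< n<v _ _ | tri> _ _ v<p =
    ⊥-elim (triangle-free (symmetric (edge-next v)) (edge-prev v) (transitive n<v v<p (symmetric (edge-next v)) (edge-prev v)))
  ... | tri> _ _ v<n | tri< p<v _ _ =
    ⊥-elim (triangle-free (symmetric (edge-prev v)) (edge-next v) (transitive p<v v<n (symmetric (edge-prev v)) (edge-next v)))

  R-of-right-neighbour : ∀ {v w} → E v w → v < w → R v
  R-of-right-neighbour {v} {w} e v<w with R-or-L v
  ... | inj₁ Rv = Rv
  ... | inj₂ Lv = ⊥-elim (ℤP.<-asym v<w (Lv w e))

  -- If each neighbour of k is n or lies beyond n as seen from k, then k ~ n: otherwise,
  -- by convexity, n would be adjacent to both neighbours of k, closing a 4-cycle.
  near-neighbour : ∀ {k n} → k ≢ n → (∀ {c} → E k c → c ≡ n ⊎ Between k n c) → E k n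
  near-neighbour {k} {n} k≢n beyond = combine (via (edge-next k)) (via (edge-prev k))
    where
    via : ∀ {c} → E k c → E k n ⊎ E n c
    via e with beyond e
    ... | inj₁ refl = inj₁ e
    ... | inj₂ between = split-between between e
    combine : E k n ⊎ E n (next k) → E k n ⊎ E n (prev k) → E k n
    combine (inj₁ e) _ = e
    combine (inj₂ _) (inj₁ e) = e
    combine (inj₂ e₁) (inj₂ e₂) = ⊥-elim (square-free k≢n (next≢prev k) (edge-next k) (edge-prev k) e₁ e₂)

  R-next : ∀ {k} → R k → E k (k + 1ℤ)
  R-next {k} Rk = near-neighbour (ℤP.<⇒≢ (<-+1 k))
    (λ e → Sum.map₂ (λ k+1<c → inj₁ (<-+1 k , k+1<c)) (successor-or-beyond (Rk _ e)))

  L-prev : ∀ {k} → L k → E k (k - 1ℤ)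
  L-prev {k} Lk = near-neighbour (≢-sym (ℤP.<⇒≢ (-1-< k)))
    (λ e → Sum.map₂ (λ c<k-1 → inj₂ (c<k-1 , -1-< k)) (predecessor-or-below (Lk _ e)))

  -- An R vertex k is not adjacent to k+2: the other neighbour c of k+2 would lie left of k
  -- and be adjacent to k+1, so k and c would share the neighbours k+1 and k+2.
  R-not-adjacent-+2 : ∀ {k} → R k → ¬ E k (k + + 2)
  R-not-adjacent-+2 {k} Rk e₂ with R-or-L (k + + 2)
  ... | inj₁ R₂ = ℤP.<-asym (base-< k 1) (R₂ k (symmetric e₂))
  ... | inj₂ L₂ with another-neighbour (k + + 2) k
  ... | c , c≢k , e-c = square-free (≢-sym c≢k) (ℤP.<⇒≢ (shift-< k 1 2)) e₁ e₂ c~k+1 (symmetric e-c)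
    where
    e₁ : E k (k + 1ℤ)
    e₁ = R-next Rk
    c≢k+1 : c ≢ k + 1ℤ
    c≢k+1 refl = triangle-free e₁ (symmetric e-c) e₂
    c<k : c < k
    c<k with ℤP.<-cmp c k
    ... | tri< c<k _ _ = c<k
    ... | tri≈ _ c≡k _ = ⊥-elim (c≢k c≡k)
    ... | tri> _ _ k<c = ⊥-elim (c≢k+1 (strictly-between-+2 k<c (L₂ c e-c)))
    c~k+1 : E c (k + 1ℤ)
    c~k+1 with split (ℤP.<-trans c<k (<-+1 k)) (shift-< k 1 2) (symmetric e-c)
    ... | inj₁ e = e
    ... | inj₂ e = ⊥-elim (triangle-free e₁ e e₂)

  bridge : ∀ {k b j} → R k → E k b → k + 1ℤ < j → j < b → E j b
  bridge {k} Rk e k+1<j j<b with split (ℤP.<-trans (<-+1 k) k+1<j) j<b e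
  ... | inj₂ e′ = e′
  ... | inj₁ e-kj with at-most-two (R-next Rk) e (ℤP.<⇒≢ (ℤP.<-trans k+1<j j<b)) e-kj
  ...   | inj₁ j≡k+1 = ⊥-elim (ℤP.<-irrefl (sym j≡k+1) k+1<j)
  ...   | inj₂ j≡b = ⊥-elim (ℤP.<-irrefl j≡b j<b)

  R-neighbours : ∀ {k} → R k → E k (k + + 3) × E (k + + 2) (k + + 3)
  R-neighbours {k} Rk with another-neighbour k (k + 1ℤ)
  ... | b , b≢k+1 , e with successor-or-beyond (Rk b e)
  ... | inj₁ b≡k+1 = ⊥-elim (b≢k+1 b≡k+1)
  ... | inj₂ k+1<b with next-offset-or-beyond k 1 k+1<b
  ... | inj₁ b≡k+2 = ⊥-elim (R-not-adjacent-+2 Rk (subst (E k) b≡k+2 e))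
  ... | inj₂ k+2<b with next-offset-or-beyond k 2 k+2<b
  ... | inj₁ b≡k+3 = subst (E k) b≡k+3 e , subst (E (k + + 2)) b≡k+3 (bridge Rk e (shift-< k 1 2) k+2<b)
  ... | inj₂ k+3<b =
    ⊥-elim (Sum.[ ≢-sym (ℤP.<⇒≢ (base-< k 2)) , ≢-sym (ℤP.<⇒≢ (shift-< k 2 3)) ]
      (at-most-two (symmetric e) (symmetric (bridge Rk e (shift-< k 1 2) k+2<b)) (ℤP.<⇒≢ (base-< k 1))
                   (symmetric (bridge Rk e (shift-< k 1 3) k+3<b))))

  R-exactly : ∀ {k w} → R k → E k w → w ≡ k + 1ℤ ⊎ w ≡ k + + 3
  R-exactly {k} Rk = at-most-two (R-next Rk) (proj₁ (R-neighbours Rk)) (ℤP.<⇒≢ (shift-< k 1 3))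

  R-forward : ∀ {k} → R k → R (k + + 2)
  R-forward {k} Rk = R-of-right-neighbour (proj₂ (R-neighbours Rk)) (shift-< k 2 3)

  L-left : ∀ {v} → L v → R (v - 1ℤ)
  L-left {v} Lv = R-of-right-neighbour (symmetric (L-prev Lv)) (-1-< v)

  R-backward : ∀ {k} → R k → R (k - + 2)
  R-backward {k} Rk with R-or-L (k - 1ℤ)
  ... | inj₁ R₁ = ⊥-elim (ℤP.<-asym (-1-< k) (Rk (k - 1ℤ) (symmetric (subst (E (k - 1ℤ)) (-1+1 k) (R-next R₁)))))
  ... | inj₂ L₁ = subst R (ℤP.+-assoc k (- 1ℤ) (- 1ℤ)) (L-left L₁)

  some-R : ∃[ c ] R c
  some-R with R-or-L 0ℤ
  ... | inj₁ R₀ = 0ℤ , R₀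
  ... | inj₂ L₀ = 0ℤ - 1ℤ , L-left L₀

  R-along : ∀ {c} → R c → ∀ t → R (c + + 2 * t)
  R-along {c} Rc = ℤ-induction (λ t → R (c + + 2 * t)) (subst R (zero-step c) Rc)
    (λ t Rt → subst R (step-up c t) (R-forward Rt)) (λ t Rt → subst R (step-down c t) (R-backward Rt))
    where
    zero-step : ∀ c → c ≡ c + + 2 * 0ℤ
    zero-step = solve-∀
    step-up : ∀ c t → (c + + 2 * t) + + 2 ≡ c + + 2 * (t + 1ℤ)
    step-up = solve-∀
    step-down : ∀ c t → (c + + 2 * t) - + 2 ≡ c + + 2 * (t - 1ℤ)
    step-down = solve-∀

  -- For R r, below r+3 only r and r+2 are inverted with r+3, and above r+2 only r+3 and
  -- r+5 are inverted with r+2; so the values strictly between ω(r+3) and ω(r+2) are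
  -- taken at r and r+5 only.
  window : ∀ {r} → R r → ∀ m → ω (r + + 3) < ω m → ω m < ω (r + + 2) → m ≡ r ⊎ m ≡ r + + 5
  window {r} Rr m above below with ℤP.<-cmp m (r + + 3)
  ... | tri< m<r+3 _ _ =
    Sum.map₂ (λ m≡r+2 → ⊥-elim (ℤP.<-irrefl (cong ω m≡r+2) below))
      (at-most-two (symmetric (proj₁ (R-neighbours Rr))) (symmetric (proj₂ (R-neighbours Rr)))
                   (ℤP.<⇒≢ (base-< r 1)) (symmetric (inverted→edge m<r+3 above)))
  ... | tri≈ _ m≡r+3 _ = ⊥-elim (ℤP.<-irrefl (cong ω (sym m≡r+3)) above)
  ... | tri> _ _ r+3<m =
    Sum.map (λ m≡r+3 → ⊥-elim (ℤP.<-irrefl (sym (trans m≡r+3 (ℤP.+-assoc r (+ 2) 1ℤ))) r+3<m)) (λ m≡r+5 → trans m≡r+5 (ℤP.+-assoc r (+ 2) (+ 3)))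
      (R-exactly (R-forward Rr) (inverted→edge (ℤP.<-trans (shift-< r 2 3) r+3<m) below))

  -- Since ω is onto, the window holds exactly the two integers ω r < ω(r+5).
  values : ∀ {r} → R r → ω (r + + 3) ≡ ω r - 1ℤ × ω (r + + 2) ≡ ω r + + 2
  values {r} Rr =
      trans (sym (+1-1 _)) (cong (_- 1ℤ) (sym (proj₁ consecutive)))
    , trans (proj₂ (proj₂ consecutive)) (trans (cong (_+ 1ℤ) (proj₁ (proj₂ consecutive))) (ℤP.+-assoc (ω r) 1ℤ 1ℤ))
    where
    e₂₅ : E (r + + 2) (r + + 5)
    e₂₅ = subst (E (r + + 2)) (ℤP.+-assoc r (+ 2) (+ 3)) (proj₁ (R-neighbours (R-forward Rr)))
    no-e₀₅ : ¬ E r (r + + 5)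
    no-e₀₅ e = Sum.[ (λ eq → ℤP.<-irrefl (sym eq) (shift-< r 1 5)) , (λ eq → ℤP.<-irrefl (sym eq) (shift-< r 3 5)) ]
                 (R-exactly Rr e)
    only : ∀ v → ω (r + + 3) < v → v < ω (r + + 2) → v ≡ ω r ⊎ v ≡ ω (r + + 5)
    only v above below =
      Sum.map (λ m≡r → trans (sym (ω-onto v)) (cong ω m≡r)) (λ m≡r+5 → trans (sym (ω-onto v)) (cong ω m≡r+5))
        (window Rr (ω⁻¹ v) (subst (_ <_) (sym (ω-onto v)) above) (subst (_< _) (sym (ω-onto v)) below))
    consecutive : ω r ≡ ω (r + + 3) + 1ℤ × ω (r + + 5) ≡ ω r + 1ℤ × ω (r + + 2) ≡ ω (r + + 5) + 1ℤ
    consecutive = four-consecutive (edge→inverted (base-< r 2) (proj₁ (R-neighbours Rr)))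
                    (non-edge→ordered (base-< r 4) no-e₀₅) (edge→inverted (shift-< r 2 5) e₂₅) only

  shape : ∀ {c} → R c → ∀ t → ω (c + + 2 * t) ≡ ω c + + 2 * t × ω (c + + 2 * t + 1ℤ) ≡ ω c + + 2 * t - + 3
  shape {c} Rc t = even t , odd
    where
    step-up : ∀ c t → (c + + 2 * t) + + 2 ≡ c + + 2 * (t + 1ℤ)
    step-up = solve-∀
    even : ∀ t → ω (c + + 2 * t) ≡ ω c + + 2 * t
    even t = trans (arithmetic-progression (λ s → ω (c + + 2 * s)) (+ 2)
                      (λ s → trans (cong ω (sym (step-up c s))) (proj₂ (values (R-along Rc s)))) t)
                   (cong (λ x → ω x + + 2 * t) (ℤP.+-identityʳ c))
    odd-position : ∀ c t → (c + + 2 * (t - 1ℤ)) + + 3 ≡ c + + 2 * t + 1ℤ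
    odd-position = solve-∀
    odd-value : ∀ e t → (e + + 2 * (t - 1ℤ)) - 1ℤ ≡ e + + 2 * t - + 3
    odd-value = solve-∀
    odd : ω (c + + 2 * t + 1ℤ) ≡ ω c + + 2 * t - + 3
    odd = begin
      ω (c + + 2 * t + 1ℤ)                  ≡⟨ cong ω (sym (odd-position c t)) ⟩
      ω (c + + 2 * (t - 1ℤ) + + 3)          ≡⟨ proj₁ (values (R-along Rc (t - 1ℤ))) ⟩
      ω (c + + 2 * (t - 1ℤ)) - 1ℤ           ≡⟨ cong (_- 1ℤ) (even (t - 1ℤ)) ⟩
      (ω c + + 2 * (t - 1ℤ)) - 1ℤ           ≡⟨ odd-value (ω c) t ⟩
      ω c + + 2 * t - + 3                   ∎
      where open ≡-Reasoning

lemma5p4 : (ω : ℤ → ℤ) → Bij ω → IsDoublyInfinitePath (InvEdge ω) →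
    ∃[ φ ] ∃[ φ′ ] (OrderIso φ × OrderIso φ′ ×
      (((i : ℤ) → ω (φ i) ≡ φ′ (osc i)) ⊎ ((i : ℤ) → ω (φ i) ≡ φ′ (Σosc i))))
lemma5p4 ω ω-bij path =
    (λ i → i + c) , (λ j → j + (ω c - + 2)) , translation-iso c , translation-iso (ω c - + 2)
  , inj₂ (matches-Σosc ω c (ω c) (shape Rc))
  where
  open PathInversionGraph ω ω-bij path
  c : ℤ
  c = proj₁ some-R
  Rc : R c
  Rc = proj₂ some-R
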